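{- Let $\mathcal F$ be a 3-uniform hypergraph that is three-partite and linear. Then $\mathcal F$ is 2-cancellative if and only if it contains no copy of $\mathbb G_6$ and no copy of $\mathbb G_7$. Also, $\mathcal F$ is $\mathbb G(7,4)$-sparse if and only if it contains no copy of $\mathbb G_6$ and no copy of $\mathbb G_7$.
   Context: A 3-uniform hypergraph is three-partite if its vertex set can be partitioned into $V_1\cup V_2\cup V_3$ with every edge meeting each $V_i$ in exactly one vertex; it is linear if any two distinct edges share at most one vertex. A family $\mathcal F$ is 2-cancellative if for all four distinct members $A_1,A_2,B,C\in\mathcal F$ we have $A_1\cup A_2\cup B\neq A_1\cup A_2\cup C$. $\mathcal F$ is $\mathbb G(7,4)$-sparse if it has no 4 distinct edges whose union has at most 7 vertices. $\mathbb G_6$ is the hypergraph on vertices $\{1,\dots,6\}$ with edges $\{1,2,3\},\{1,5,6\},\{4,2,6\},\{4,5,3\}$; $\mathbb G_7$ is the hypergraph on vertices $\{1,\dots,7\}$ with edges $\{1,2,3\},\{4,5,6\},\{7,2,6\},\{7,5,3\}$. "Contains a copy" means has a subfamily of edges isomorphic to the given hypergraph. -}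

module Defs where

open import Data.Nat using (ℕ; _≤_)
open import Data.Fin using (Fin; zero; suc; _≟_)
open import Data.Fin.Subset using (Subset; _∩_; _∪_; ⁅_⁆; ∣_∣)
open import Data.Vec using (tabulate)
open import Data.List using (List; []; _∷_)
open import Data.List.Membership.Propositional using (_∈_)
open import Data.List.Relation.Unary.All using (All)
open import Data.List.Relation.Unary.Unique.Propositional using (Unique)
open import Data.Product using (Σ; ∃; _×_; _,_)
open import Relation.Nullary using (¬_; does)
open import Relation.Binary.PropositionalEquality using (_≡_; _≢_)
open import Function.Definitions using (Injective)

record Hypergraph3 (n : ℕ) : Set where
  field
    edges   : List (Subset n)
    unique  : Unique edges
    uniform : All (λ e → ∣ e ∣ ≡ 3) edges
open Hypergraph3 public

colourClass : ∀ {n} → (Fin n → Fin 3) → Fin 3 → Subset n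
colourClass c i = tabulate (λ v → does (c v ≟ i))

ThreePartite : ∀ {n} → Hypergraph3 n → Set
ThreePartite {n} H = Σ (Fin n → Fin 3) λ c →
  ∀ e → e ∈ edges H → ∀ i → ∣ e ∩ colourClass c i ∣ ≡ 1

Linear : ∀ {n} → Hypergraph3 n → Set
Linear H = ∀ e f → e ∈ edges H → f ∈ edges H → e ≢ f → ∣ e ∩ f ∣ ≤ 1

Distinct4 : ∀ {n} → Subset n → Subset n → Subset n → Subset n → Set
Distinct4 a b c d = a ≢ b × a ≢ c × a ≢ d × b ≢ c × b ≢ d × c ≢ d

TwoCancellative : ∀ {n} → Hypergraph3 n → Set
TwoCancellative H = ∀ A₁ A₂ B C →
  A₁ ∈ edges H → A₂ ∈ edges H → B ∈ edges H → C ∈ edges H →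
  Distinct4 A₁ A₂ B C → (A₁ ∪ A₂ ∪ B) ≢ (A₁ ∪ A₂ ∪ C)

G74Sparse : ∀ {n} → Hypergraph3 n → Set
G74Sparse H = ∀ A B C D →
  A ∈ edges H → B ∈ edges H → C ∈ edges H → D ∈ edges H →
  Distinct4 A B C D → ¬ (∣ A ∪ B ∪ C ∪ D ∣ ≤ 7)

record Triple (m : ℕ) : Set where
  constructor ⟨_,_,_⟩
  field
    x y z : Fin m

image : ∀ {m n} → (Fin m → Fin n) → Triple m → Subset n
image φ ⟨ a , b , c ⟩ = ⁅ φ a ⁆ ∪ ⁅ φ b ⁆ ∪ ⁅ φ c ⁆

ContainsCopy : ∀ {n} → (m : ℕ) → List (Triple m) → Hypergraph3 n → Set
ContainsCopy {n} m P H = Σ (Fin m → Fin n) λ φ →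
  Injective _≡_ _≡_ φ × All (λ t → image φ t ∈ edges H) P

-- vertices 1..6 of the paper are 0..5 here
v0 v1 v2 v3 v4 v5 v6 : Fin 7
v0 = zero
v1 = suc zero
v2 = suc (suc zero)
v3 = suc (suc (suc zero))
v4 = suc (suc (suc (suc zero)))
v5 = suc (suc (suc (suc (suc zero))))
v6 = suc (suc (suc (suc (suc (suc zero)))))

-- 𝔾₆ on {1..6}: {1,2,3},{1,5,6},{4,2,6},{4,5,3}
G6 : List (Triple 6)
G6 = ⟨ zero , suc zero , suc (suc zero) ⟩
   ∷ ⟨ zero , suc (suc (suc (suc zero))) , suc (suc (suc (suc (suc zero)))) ⟩
   ∷ ⟨ suc (suc (suc zero)) , suc zero , suc (suc (suc (suc (suc zero)))) ⟩
   ∷ ⟨ suc (suc (suc zero)) , suc (suc (suc (suc zero))) , suc (suc zero) ⟩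
   ∷ []

-- 𝔾₇ on {1..7}: {1,2,3},{4,5,6},{7,2,6},{7,5,3}
G7 : List (Triple 7)
G7 = ⟨ v0 , v1 , v2 ⟩
   ∷ ⟨ v3 , v4 , v5 ⟩
   ∷ ⟨ v6 , v1 , v5 ⟩
   ∷ ⟨ v6 , v4 , v2 ⟩
   ∷ []

module Submission where

-- (1) 𝔾₆ and 𝔾₇ have four distinct edges on at most seven vertices, and in
--     both the last two edges are exchangeable over the union of the first
--     two; so any copy violates both properties (copy-¬cancellative,
--     copy-¬sparse, checked for the two patterns by evaluation).
-- (2) In every linear 3-graph a cancellation failure A₁ ∪ A₂ ∪ B = A₁ ∪ A₂ ∪ C
--     lies inside A₁ ∪ A₂ ∪ (B ∩ C), which has at most 3 + 3 + 1 vertices;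
--     hence G(7,4)-sparse implies 2-cancellative (sparse⇒cancellative).
-- (3) Four distinct edges of a linear three-partite F on at most seven
--     vertices form a copy of 𝔾₆ or 𝔾₇ (small-quadruple⇒copy).  Each edge has
--     one vertex per colour, so up to isomorphism the four edges are described
--     by their pattern: per colour, the partition of the edges by their vertex
--     of that colour, stored as a normal form (15 choices, 3375 patterns).
--     Every pattern gets a certificate, found by search and checked by
--     evaluation (exhaustive): two edges sharing two vertices, eight distinct
--     vertices, or a placement of the vertices of 𝔾₆ or 𝔾₇.

open import Defs
open import Data.Nat using (zero; suc; _+_; _≤_; _≤?_; z≤n; s≤s)
open import Data.Nat.Properties
  using (≤-trans; ≤-refl; <-irrefl; 0≢1+n; ≤-reflexive; +-suc; +-monoʳ-≤; +-mono-≤; m≤n⇒m≤1+n; module ≤-Reasoning)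
open import Data.Bool using (Bool; true; false; not; _∨_; _xor_; if_then_else_)
open import Data.Bool.ListAction using (and)
open import Data.Unit using (tt)
open import Data.Empty using (⊥; ⊥-elim)
open import Data.Fin using (Fin; zero; suc; _≟_)
open import Data.Fin.Properties using (all?)
open import Data.Fin.Subset using (Subset; _∈_; _⊆_; _∪_; _∩_; _-_; ⁅_⁆; ∣_∣) renaming (⊥ to ∅)
open import Data.Fin.Subset.Properties
  using ( _⊆?_; ⊆-antisym; p⊆q⇒∣p∣≤∣q∣; p⊆p∪q; q⊆p∪q; x∈p∪q⁺; x∈p∪q⁻; x∈p∩q⁺; x∈p∩q⁻
        ; x∈⁅x⁆; x∈⁅y⁆⇒x≡y; ∣⁅x⁆∣≡1; ∣⊥∣≡0; ∣p∣≤∣x∷p∣; nonempty?; Empty-unique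
        ; x∈p⇒∣p-x∣<∣p∣; x∈p∧x≢y⇒x∈p-y)
open import Data.Vec using (Vec; []; _∷_; lookup; tabulate)
import Data.Vec.Properties as Vec
import Data.Vec.Relation.Unary.All as VecAll
open import Data.List
  using (List; []; _∷_; length; map; filter; allFin; concatMap; cartesianProductWith; cartesianProduct; zip; _++_; findᵇ)
open import Data.List.Properties using (length-map)
open import Data.List.Membership.Propositional using () renaming (_∈_ to _∈ᴸ_)
open import Data.List.Membership.Propositional.Properties using (∈-allFin; ∈-filter⁺; ∈-cartesianProductWith⁺)
open import Data.List.Relation.Unary.All using (All; []; _∷_)
import Data.List.Relation.Unary.All as All
import Data.List.Relation.Unary.All.Properties as All using (map⁺)
open import Data.List.Relation.Unary.Any using (any?; here; there)
open import Data.List.Relation.Unary.AllPairs using (AllPairs; allPairs?; []; _∷_)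
import Data.List.Relation.Unary.AllPairs as AllPairs
import Data.List.Relation.Unary.AllPairs.Properties as AllPairs
open import Data.List.Relation.Unary.Unique.Propositional using (Unique)
open import Data.List.Relation.Binary.Pointwise using (Pointwise; []; _∷_)
import Data.List.Relation.Binary.Pointwise.Properties as Pointwise
open import Data.Maybe using (fromMaybe)
import Data.Maybe as Maybe
open import Data.Product using (Σ; ∃; _×_; _,_; proj₁; proj₂)
open import Data.Sum using (_⊎_; inj₁; inj₂; [_,_])
import Data.Sum as Sum
open import Function using (id)
open import Function.Bundles using (_⇔_; mk⇔)
open import Function.Definitions using (Injective)
open import Relation.Nullary using (¬_; Dec; yes; no; does)
open import Relation.Nullary.Decidable using (toWitness; dec-true; _×-dec_; _⊎-dec_; _→-dec_; ¬?)
open import Relation.Binary.PropositionalEquality using (_≡_; refl; sym; trans; cong; subst; _≢_)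

card-lower : ∀ {n} {S : Subset n} (xs : List (Fin n)) → Unique xs → All (_∈ S) xs →
             length xs ≤ ∣ S ∣
card-lower [] _ _ = z≤n
card-lower {S = S} (x ∷ xs) (x∉xs ∷ u) (x∈S ∷ xs⊆S) =
  ≤-trans (s≤s (card-lower {S = S - x} xs u (removed xs x∉xs xs⊆S))) (x∈p⇒∣p-x∣<∣p∣ x∈S)
  where
  removed : ∀ ys → All (x ≢_) ys → All (_∈ S) ys → All (_∈ S - x) ys
  removed [] [] [] = []
  removed (y ∷ ys) (x≢y ∷ d) (y∈S ∷ m) = x∈p∧x≢y⇒x∈p-y y∈S (λ y≡x → x≢y (sym y≡x)) ∷ removed ys d m

∣p∪q∣≤∣p∣+∣q∣ : ∀ {n} (p q : Subset n) → ∣ p ∪ q ∣ ≤ ∣ p ∣ + ∣ q ∣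
∣p∪q∣≤∣p∣+∣q∣ [] [] = z≤n
∣p∪q∣≤∣p∣+∣q∣ (true ∷ p) (t ∷ q) = s≤s (≤-trans (∣p∪q∣≤∣p∣+∣q∣ p q) (+-monoʳ-≤ ∣ p ∣ (∣p∣≤∣x∷p∣ t q)))
∣p∪q∣≤∣p∣+∣q∣ (false ∷ p) (true ∷ q) =
  subst (suc ∣ p ∪ q ∣ ≤_) (sym (+-suc ∣ p ∣ ∣ q ∣)) (s≤s (∣p∪q∣≤∣p∣+∣q∣ p q))
∣p∪q∣≤∣p∣+∣q∣ (false ∷ p) (false ∷ q) = ∣p∪q∣≤∣p∣+∣q∣ p q

singleton-elem : ∀ {n} (S : Subset n) → ∣ S ∣ ≡ 1 →
                 Σ (Fin n) λ v → v ∈ S × (∀ {w} → w ∈ S → w ≡ v)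
singleton-elem {n} S ∣S∣≡1 with nonempty? S
... | no empty = ⊥-elim (0≢1+n (trans (sym ∣S∣≡0) ∣S∣≡1))
  where
  ∣S∣≡0 : ∣ S ∣ ≡ 0
  ∣S∣≡0 = trans (cong ∣_∣ (Empty-unique empty)) (∣⊥∣≡0 n)
... | yes (v , v∈S) = v , v∈S , only
  where
  only : ∀ {w} → w ∈ S → w ≡ v
  only {w} w∈S with w ≟ v
  ... | yes w≡v = w≡v
  ... | no w≢v = ⊥-elim (<-irrefl refl (subst (2 ≤_) ∣S∣≡1
          (card-lower (w ∷ v ∷ []) ((w≢v ∷ []) ∷ [] ∷ []) (w∈S ∷ v∈S ∷ []))))

∪-⊆ : ∀ {n} {p q r : Subset n} → p ⊆ r → q ⊆ r → p ∪ q ⊆ r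
∪-⊆ {p = p} {q} p⊆r q⊆r x∈p∪q = [ p⊆r , q⊆r ] (x∈p∪q⁻ p q x∈p∪q)

∈-triple⁻ : ∀ {n} {a b c w : Fin n} → w ∈ ⁅ a ⁆ ∪ ⁅ b ⁆ ∪ ⁅ c ⁆ → w ≡ a ⊎ w ≡ b ⊎ w ≡ c
∈-triple⁻ {a = a} {b} {c} w∈ =
  Sum.map (x∈⁅y⁆⇒x≡y a) (λ w∈bc → Sum.map (x∈⁅y⁆⇒x≡y b) (x∈⁅y⁆⇒x≡y c) (x∈p∪q⁻ ⁅ b ⁆ ⁅ c ⁆ w∈bc))
    (x∈p∪q⁻ ⁅ a ⁆ (⁅ b ⁆ ∪ ⁅ c ⁆) w∈)

∈-triple⁺ : ∀ {n} {a b c w : Fin n} → w ≡ a ⊎ w ≡ b ⊎ w ≡ c → w ∈ ⁅ a ⁆ ∪ ⁅ b ⁆ ∪ ⁅ c ⁆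
∈-triple⁺ (inj₁ refl) = x∈p∪q⁺ (inj₁ (x∈⁅x⁆ _))
∈-triple⁺ (inj₂ (inj₁ refl)) = x∈p∪q⁺ (inj₂ (x∈p∪q⁺ (inj₁ (x∈⁅x⁆ _))))
∈-triple⁺ (inj₂ (inj₂ refl)) = x∈p∪q⁺ (inj₂ (x∈p∪q⁺ (inj₂ (x∈⁅x⁆ _))))

vertices : ∀ {m} → Triple m → Subset m
vertices = image (λ u → u)

∈-image⁺ : ∀ {m n} (φ : Fin m → Fin n) t {u} → u ∈ vertices t → φ u ∈ image φ t
∈-image⁺ φ ⟨ a , b , c ⟩ u∈t = ∈-triple⁺ (Sum.map (cong φ) (Sum.map (cong φ) (cong φ)) (∈-triple⁻ u∈t))

∈-image⁻ : ∀ {m n} (φ : Fin m → Fin n) t {w} → w ∈ image φ t → ∃ λ u → u ∈ vertices t × w ≡ φ u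
∈-image⁻ φ ⟨ a , b , c ⟩ w∈ with ∈-triple⁻ w∈
... | inj₁ w≡φa = a , ∈-triple⁺ (inj₁ refl) , w≡φa
... | inj₂ (inj₁ w≡φb) = b , ∈-triple⁺ (inj₂ (inj₁ refl)) , w≡φb
... | inj₂ (inj₂ w≡φc) = c , ∈-triple⁺ (inj₂ (inj₂ refl)) , w≡φc

image-injective : ∀ {m n} {φ : Fin m → Fin n} → Injective _≡_ _≡_ φ →
                  ∀ {t t'} → image φ t ≡ image φ t' → vertices t ≡ vertices t'
image-injective {φ = φ} inj {t} {t'} eq = ⊆-antisym (into eq) (into (sym eq))
  where
  into : ∀ {s s'} → image φ s ≡ image φ s' → vertices s ⊆ vertices s'
  into {s} {s'} eq u∈s with ∈-image⁻ φ s' (subst (φ _ ∈_) eq (∈-image⁺ φ s u∈s))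
  ... | u' , u'∈s' , φu≡φu' = subst (_∈ vertices s') (sym (inj φu≡φu')) u'∈s'

range : ∀ {m n} → (Fin m → Fin n) → Subset n
range {zero} φ = ∅
range {suc m} φ = ⁅ φ zero ⁆ ∪ range (λ u → φ (suc u))

∣range∣≤ : ∀ {m n} (φ : Fin m → Fin n) → ∣ range φ ∣ ≤ m
∣range∣≤ {zero} {n} φ = subst (_≤ 0) (sym (∣⊥∣≡0 n)) z≤n
∣range∣≤ {suc m} φ = ≤-trans (∣p∪q∣≤∣p∣+∣q∣ ⁅ φ zero ⁆ _)
  (subst (λ k → k + ∣ range (λ u → φ (suc u)) ∣ ≤ suc m) (sym (∣⁅x⁆∣≡1 (φ zero))) (s≤s (∣range∣≤ (λ u → φ (suc u)))))

∈-range : ∀ {m n} (φ : Fin m → Fin n) u → φ u ∈ range φ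
∈-range φ zero = x∈p∪q⁺ (inj₁ (x∈⁅x⁆ (φ zero)))
∈-range φ (suc u) = x∈p∪q⁺ (inj₂ (∈-range (λ v → φ (suc v)) u))

image-⊆-range : ∀ {m n} (φ : Fin m → Fin n) t → image φ t ⊆ range φ
image-⊆-range φ t w∈ with ∈-image⁻ φ t w∈
... | u , _ , refl = ∈-range φ u

∪-exchange : ∀ {n} {A₁ A₂ B C : Subset n} → B ⊆ A₁ ∪ A₂ ∪ C → C ⊆ A₁ ∪ A₂ ∪ B →
             A₁ ∪ A₂ ∪ B ≡ A₁ ∪ A₂ ∪ C
∪-exchange {A₁ = A₁} {A₂} B⊆ C⊆ = ⊆-antisym (absorb B⊆) (absorb C⊆)
  where
  absorb : ∀ {X Y} → X ⊆ A₁ ∪ A₂ ∪ Y → A₁ ∪ A₂ ∪ X ⊆ A₁ ∪ A₂ ∪ Y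
  absorb X⊆ = ∪-⊆ (p⊆p∪q _) (∪-⊆ (λ x∈A₂ → q⊆p∪q A₁ _ (p⊆p∪q _ x∈A₂)) X⊆)

images-distinct : ∀ {m n} {φ : Fin m → Fin n} → Injective _≡_ _≡_ φ → ∀ {t₁ t₂ t₃ t₄} →
                  Distinct4 (vertices t₁) (vertices t₂) (vertices t₃) (vertices t₄) →
                  Distinct4 (image φ t₁) (image φ t₂) (image φ t₃) (image φ t₄)
images-distinct {φ = φ} inj (d₁₂ , d₁₃ , d₁₄ , d₂₃ , d₂₄ , d₃₄) =
  sep d₁₂ , sep d₁₃ , sep d₁₄ , sep d₂₃ , sep d₂₄ , sep d₃₄
  where
  sep : ∀ {t t'} → vertices t ≢ vertices t' → image φ t ≢ image φ t'
  sep d eq = d (image-injective inj eq)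

copy-¬cancellative : ∀ {n} (F : Hypergraph3 n) {m} {t₁ t₂ t₃ t₄ : Triple m} →
  Distinct4 (vertices t₁) (vertices t₂) (vertices t₃) (vertices t₄) →
  vertices t₃ ⊆ vertices t₁ ∪ vertices t₂ ∪ vertices t₄ →
  vertices t₄ ⊆ vertices t₁ ∪ vertices t₂ ∪ vertices t₃ →
  ContainsCopy m (t₁ ∷ t₂ ∷ t₃ ∷ t₄ ∷ []) F → ¬ TwoCancellative F
copy-¬cancellative F {t₃ = t₃} {t₄} distinct t₃⊆ t₄⊆ (φ , inj , e₁ ∷ e₂ ∷ e₃ ∷ e₄ ∷ []) tc =
  tc _ _ _ _ e₁ e₂ e₃ e₄ (images-distinct inj distinct) (∪-exchange (transport t₃ t₃⊆) (transport t₄ t₄⊆))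
  where
  transport : ∀ t {s₁ s₂ s₃} → vertices t ⊆ vertices s₁ ∪ vertices s₂ ∪ vertices s₃ →
              image φ t ⊆ image φ s₁ ∪ image φ s₂ ∪ image φ s₃
  transport t {s₁} {s₂} {s₃} t⊆ w∈ with ∈-image⁻ φ t w∈
  ... | u , u∈t , refl with x∈p∪q⁻ (vertices s₁) _ (t⊆ u∈t)
  ...   | inj₁ u∈s₁ = x∈p∪q⁺ (inj₁ (∈-image⁺ φ s₁ u∈s₁))
  ...   | inj₂ u∈s₂s₃ = x∈p∪q⁺ (inj₂ (x∈p∪q⁺ (Sum.map (∈-image⁺ φ s₂) (∈-image⁺ φ s₃)
                                                 (x∈p∪q⁻ (vertices s₂) _ u∈s₂s₃))))

copy-¬sparse : ∀ {n} (F : Hypergraph3 n) {m} {t₁ t₂ t₃ t₄ : Triple m} →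
  Distinct4 (vertices t₁) (vertices t₂) (vertices t₃) (vertices t₄) → m ≤ 7 →
  ContainsCopy m (t₁ ∷ t₂ ∷ t₃ ∷ t₄ ∷ []) F → ¬ G74Sparse F
copy-¬sparse F {t₁ = t₁} {t₂} {t₃} {t₄} distinct m≤7 (φ , inj , e₁ ∷ e₂ ∷ e₃ ∷ e₄ ∷ []) sp =
  sp _ _ _ _ e₁ e₂ e₃ e₄ (images-distinct inj distinct)
     (≤-trans (p⊆q⇒∣p∣≤∣q∣ in-range) (≤-trans (∣range∣≤ φ) m≤7))
  where
  in-range : image φ t₁ ∪ image φ t₂ ∪ image φ t₃ ∪ image φ t₄ ⊆ range φ
  in-range = ∪-⊆ (image-⊆-range φ t₁) (∪-⊆ (image-⊆-range φ t₂)
               (∪-⊆ (image-⊆-range φ t₃) (image-⊆-range φ t₄)))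

-- 𝔾₆ and 𝔾₇ satisfy the hypotheses of both lemmas above (checked by evaluation),
-- so a hypergraph containing either is neither 2-cancellative nor G(7,4)-sparse.
cancellative⇒copy-free : ∀ {n} (F : Hypergraph3 n) → TwoCancellative F →
                         ¬ ContainsCopy 6 G6 F × ¬ ContainsCopy 7 G7 F
cancellative⇒copy-free F tc =
    (λ c → copy-¬cancellative F ((λ ()) , (λ ()) , (λ ()) , (λ ()) , (λ ()) , (λ ()))
             (toWitness {a? = _ ⊆? _} tt) (toWitness {a? = _ ⊆? _} tt) c tc)
  , (λ c → copy-¬cancellative F ((λ ()) , (λ ()) , (λ ()) , (λ ()) , (λ ()) , (λ ()))
             (toWitness {a? = _ ⊆? _} tt) (toWitness {a? = _ ⊆? _} tt) c tc)

sparse⇒copy-free : ∀ {n} (F : Hypergraph3 n) → G74Sparse F →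
                   ¬ ContainsCopy 6 G6 F × ¬ ContainsCopy 7 G7 F
sparse⇒copy-free F sp =
    (λ c → copy-¬sparse F ((λ ()) , (λ ()) , (λ ()) , (λ ()) , (λ ()) , (λ ())) (m≤n⇒m≤1+n ≤-refl) c sp)
  , (λ c → copy-¬sparse F ((λ ()) , (λ ()) , (λ ()) , (λ ()) , (λ ()) , (λ ())) ≤-refl c sp)

-- In a linear 3-graph, a failure A₁ ∪ A₂ ∪ B = A₁ ∪ A₂ ∪ C of 2-cancellativity
-- spans at most 7 vertices: every vertex of B or C outside A₁ ∪ A₂ lies in
-- B ∩ C, which has at most one element.
cancellation-failure-small : ∀ {n} (F : Hypergraph3 n) → Linear F → ∀ {A₁ A₂ B C} →
  A₁ ∈ᴸ edges F → A₂ ∈ᴸ edges F → B ∈ᴸ edges F → C ∈ᴸ edges F → B ≢ C →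
  A₁ ∪ A₂ ∪ B ≡ A₁ ∪ A₂ ∪ C → ∣ A₁ ∪ A₂ ∪ B ∪ C ∣ ≤ 7
cancellation-failure-small F lin {A₁} {A₂} {B} {C} A₁∈ A₂∈ B∈ C∈ B≢C eq = begin
  ∣ A₁ ∪ A₂ ∪ B ∪ C ∣            ≤⟨ p⊆q⇒∣p∣≤∣q∣ covered ⟩
  ∣ A₁ ∪ A₂ ∪ B ∩ C ∣            ≤⟨ ∣p∪q∣≤∣p∣+∣q∣ A₁ _ ⟩
  ∣ A₁ ∣ + ∣ A₂ ∪ B ∩ C ∣        ≤⟨ +-monoʳ-≤ ∣ A₁ ∣ (∣p∪q∣≤∣p∣+∣q∣ A₂ _) ⟩
  ∣ A₁ ∣ + (∣ A₂ ∣ + ∣ B ∩ C ∣)  ≤⟨ +-mono-≤ (size A₁∈) (+-mono-≤ (size A₂∈) (lin B C B∈ C∈ B≢C)) ⟩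
  3 + (3 + 1)                    ∎
  where
  open ≤-Reasoning
  size : ∀ {A} → A ∈ᴸ edges F → ∣ A ∣ ≤ 3
  size A∈ = ≤-reflexive (All.lookup (uniform F) A∈)
  through : ∀ {x Y} → (x ∈ Y → x ∈ B ∩ C) → x ∈ A₁ ∪ A₂ ∪ Y → x ∈ A₁ ∪ A₂ ∪ B ∩ C
  through {Y = Y} toBC x∈ =
    x∈p∪q⁺ (Sum.map id (λ x∈A₂∪Y → x∈p∪q⁺ (Sum.map id toBC (x∈p∪q⁻ A₂ Y x∈A₂∪Y))) (x∈p∪q⁻ A₁ _ x∈))
  third : ∀ {x Y} → x ∈ Y → x ∈ A₁ ∪ A₂ ∪ Y
  third x∈Y = x∈p∪q⁺ (inj₂ (x∈p∪q⁺ (inj₂ x∈Y)))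
  covered : A₁ ∪ A₂ ∪ B ∪ C ⊆ A₁ ∪ A₂ ∪ B ∩ C
  covered = ∪-⊆ (p⊆p∪q _) (∪-⊆ (λ x∈A₂ → x∈p∪q⁺ (inj₂ (x∈p∪q⁺ (inj₁ x∈A₂)))) (∪-⊆ fromB fromC))
    where
    fromB : B ⊆ A₁ ∪ A₂ ∪ B ∩ C
    fromB x∈B = through (λ x∈C → x∈p∩q⁺ (x∈B , x∈C)) (subst (_ ∈_) eq (third x∈B))
    fromC : C ⊆ A₁ ∪ A₂ ∪ B ∩ C
    fromC x∈C = through (λ x∈B → x∈p∩q⁺ (x∈B , x∈C)) (subst (_ ∈_) (sym eq) (third x∈C))

sparse⇒cancellative : ∀ {n} (F : Hypergraph3 n) → Linear F → G74Sparse F → TwoCancellative F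
sparse⇒cancellative F lin sp A₁ A₂ B C A₁∈ A₂∈ B∈ C∈ d eq =
  sp A₁ A₂ B C A₁∈ A₂∈ B∈ C∈ d (cancellation-failure-small F lin A₁∈ A₂∈ B∈ C∈ B≢C eq)
  where
  B≢C : B ≢ C
  B≢C = let (_ , _ , _ , _ , _ , b≢c) = d in b≢c

∈-colourClass⁻ : ∀ {n} (c : Fin n → Fin 3) {v i} → v ∈ colourClass c i → c v ≡ i
∈-colourClass⁻ c {v} {i} v∈ =
  accepted (c v ≟ i) (trans (sym (Vec.lookup∘tabulate (λ w → does (c w ≟ i)) v)) (Vec.[]=⇒lookup v∈))
  where
  accepted : (d : Dec (c v ≡ i)) → does d ≡ true → c v ≡ i
  accepted (yes cv≡i) _  = cv≡i
  accepted (no _)     ()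

∈-colourClass⁺ : ∀ {n} (c : Fin n → Fin 3) {v i} → c v ≡ i → v ∈ colourClass c i
∈-colourClass⁺ c {v} {i} cv≡i =
  Vec.lookup⇒[]= v _ (trans (Vec.lookup∘tabulate (λ w → does (c w ≟ i)) v) (dec-true (c v ≟ i) cv≡i))

record Coordinates {n} (c : Fin n → Fin 3) (e : Subset n) : Set where
  field
    point        : Fin 3 → Fin n
    point-colour : ∀ i → c (point i) ≡ i
    point-∈      : ∀ i → point i ∈ e
    point-unique : ∀ {w} → w ∈ e → w ≡ point (c w)

coordinates : ∀ {n} (c : Fin n → Fin 3) {e} → (∀ i → ∣ e ∩ colourClass c i ∣ ≡ 1) → Coordinates c e
coordinates {n} c {e} one-per-class = record
  { point        = λ i → proj₁ (chosen i)
  ; point-colour = λ i → ∈-colourClass⁻ c (proj₂ (x∈p∩q⁻ e _ (proj₁ (proj₂ (chosen i)))))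
  ; point-∈      = λ i → proj₁ (x∈p∩q⁻ e _ (proj₁ (proj₂ (chosen i))))
  ; point-unique = λ {w} w∈e → proj₂ (proj₂ (chosen (c w))) (x∈p∩q⁺ (w∈e , ∈-colourClass⁺ c refl))
  }
  where
  chosen : ∀ i → Σ (Fin n) λ v → v ∈ e ∩ colourClass c i × (∀ {w} → w ∈ e ∩ colourClass c i → w ≡ v)
  chosen i = singleton-elem (e ∩ colourClass c i) (one-per-class i)

vectorsOver : ∀ {A : Set} → List A → ∀ k → List (Vec A k)
vectorsOver xs zero = [] ∷ []
vectorsOver xs (suc k) = cartesianProductWith _∷_ xs (vectorsOver xs k)

∈-vectorsOver : ∀ {A : Set} {xs : List A} {k} {v : Vec A k} → VecAll.All (_∈ᴸ xs) v → v ∈ᴸ vectorsOver xs k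
∈-vectorsOver VecAll.[] = here refl
∈-vectorsOver (x∈ VecAll.∷ v∈) = ∈-cartesianProductWith⁺ _∷_ x∈ (∈-vectorsOver v∈)

-- The first entry y of ys with f y ≡ a (zero if there is none).
firstIndex : ∀ {d k} → (Fin (suc d) → Fin k) → Fin k → List (Fin (suc d)) → Fin (suc d)
firstIndex f a [] = zero
firstIndex f a (y ∷ ys) with f y ≟ a
... | yes _ = y
... | no _ = firstIndex f a ys

firstIndex-hits : ∀ {d k} (f : Fin (suc d) → Fin k) {X} ys → X ∈ᴸ ys → f (firstIndex f (f X) ys) ≡ f X
firstIndex-hits f {X} (y ∷ ys) X∈ with f y ≟ f X
... | yes fy≡fX = fy≡fX
firstIndex-hits f (y ∷ ys) (here refl) | no fy≢fX = ⊥-elim (fy≢fX refl)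
firstIndex-hits f (y ∷ ys) (there X∈) | no _ = firstIndex-hits f ys X∈

firstIndex-cong : ∀ {d k l} (f : Fin (suc d) → Fin k) (g : Fin (suc d) → Fin l) {a b} →
                  (∀ y → f y ≡ a → g y ≡ b) → (∀ y → g y ≡ b → f y ≡ a) →
                  ∀ ys → firstIndex f a ys ≡ firstIndex g b ys
firstIndex-cong f g to from [] = refl
firstIndex-cong f g {a} {b} to from (y ∷ ys) with f y ≟ a | g y ≟ b
... | yes _    | yes _    = refl
... | yes fy≡a | no gy≢b  = ⊥-elim (gy≢b (to y fy≡a))
... | no fy≢a  | yes gy≡b = ⊥-elim (fy≢a (from y gy≡b))
... | no _     | no _     = firstIndex-cong f g to from ys

representative : ∀ {d k} → (Fin (suc d) → Fin k) → Fin (suc d) → Fin (suc d)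
representative {d} f X = firstIndex f (f X) (allFin (suc d))

representative-sound : ∀ {d k} (f : Fin (suc d) → Fin k) {X Y} →
                       representative f X ≡ representative f Y → f X ≡ f Y
representative-sound f {X} {Y} eq =
  trans (sym (firstIndex-hits f _ (∈-allFin X))) (trans (cong f eq) (firstIndex-hits f _ (∈-allFin Y)))

representative-complete : ∀ {d k} (f : Fin (suc d) → Fin k) {X Y} →
                          f X ≡ f Y → representative f X ≡ representative f Y
representative-complete {d} f = cong (λ a → firstIndex f a (allFin (suc d)))

normalForm : ∀ {d k} → (Fin (suc d) → Fin k) → Vec (Fin (suc d)) (suc d)
normalForm f = tabulate (representative f)

lookup-normalForm : ∀ {d k} (f : Fin (suc d) → Fin k) X → lookup (normalForm f) X ≡ representative f X
lookup-normalForm f = Vec.lookup∘tabulate (representative f)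

normalForm-stable : ∀ {d k} (f : Fin (suc d) → Fin k) → normalForm (lookup (normalForm f)) ≡ normalForm f
normalForm-stable {d} f = Vec.tabulate-cong λ X →
  firstIndex-cong (lookup (normalForm f)) f
    (λ y eq → representative-sound f (trans (sym (lookup-normalForm f y)) (trans eq (lookup-normalForm f X))))
    (λ y eq → trans (lookup-normalForm f y) (trans (representative-complete f eq) (sym (lookup-normalForm f X))))
    (allFin (suc d))

-- A partition of the four edges of a configuration, as a normal form.
Partition4 : Set
Partition4 = Vec (Fin 4) 4

-- All 15 of them: the vectors that are their own normal form.
normalForms : List Partition4
normalForms = filter (λ q → Vec.≡-dec _≟_ (normalForm (lookup q)) q) (vectorsOver (allFin 4) 4)

-- The normal form of any map on Fin 4 is listed, being fixed by normalisation.
normalForm-∈ : ∀ {k} (f : Fin 4 → Fin k) → normalForm f ∈ᴸ normalForms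
normalForm-∈ f = ∈-filter⁺ (λ q → Vec.≡-dec _≟_ (normalForm (lookup q)) q)
  (∈-vectorsOver (VecAll.universal ∈-allFin (normalForm f))) (normalForm-stable f)

-- A pattern records, for each colour i, which of the four edges share their
-- colour-i vertex.  A label (X , i) names the colour-i vertex of edge X.
Pattern : Set
Pattern = Vec Partition4 3

Label : Set
Label = Fin 4 × Fin 3

colour : Label → Fin 3
colour = proj₂

Same : Pattern → Label → Label → Set
Same P (X , i) (Y , j) = i ≡ j × lookup (lookup P i) X ≡ lookup (lookup P i) Y

same? : ∀ P l l' → Dec (Same P l l')
same? P (X , i) (Y , j) = (i ≟ j) ×-dec (lookup (lookup P i) X ≟ lookup (lookup P i) Y)

PlacedOn : ∀ {m} → Pattern → (Fin m → Label) → Triple m → Fin 4 → Set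
PlacedOn P ℓ ⟨ a , b , c ⟩ X =
  OnX a × OnX b × OnX c × (∀ z → z ≡ colour (ℓ a) ⊎ z ≡ colour (ℓ b) ⊎ z ≡ colour (ℓ c))
  where
  OnX : _ → Set
  OnX u = Same P (ℓ u) (X , colour (ℓ u))

placedOn? : ∀ {m} P (ℓ : Fin m → Label) t X → Dec (PlacedOn P ℓ t X)
placedOn? P ℓ ⟨ a , b , c ⟩ X =
  onX? a ×-dec onX? b ×-dec onX? c ×-dec
  all? (λ z → (z ≟ colour (ℓ a)) ⊎-dec (z ≟ colour (ℓ b)) ⊎-dec (z ≟ colour (ℓ c)))
  where
  onX? : ∀ u → Dec (Same P (ℓ u) (X , colour (ℓ u)))
  onX? u = same? P (ℓ u) (X , colour (ℓ u))

-- The labels ℓ embed the pattern hypergraph pat, its k-th edge going to σ k.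
Embeds : ∀ {m} → Pattern → List (Triple m) → (Fin m → Label) → List (Fin 4) → Set
Embeds P pat ℓ σ = Pointwise (PlacedOn P ℓ) pat σ × (∀ u u' → Same P (ℓ u) (ℓ u') → u ≡ u')

embeds? : ∀ {m} P pat (ℓ : Fin m → Label) σ → Dec (Embeds P pat ℓ σ)
embeds? P pat ℓ σ = Pointwise.decidable (placedOn? P ℓ) pat σ ×-dec
                    all? (λ u → all? (λ u' → same? P (ℓ u) (ℓ u') →-dec (u ≟ u')))

data Certificate : Set where
  nonlinear : Fin 4 → Fin 4 → Fin 3 → Fin 3 → Certificate
  spread    : List Label → Certificate
  copy₆     : Vec Label 6 → List (Fin 4) → Certificate
  copy₇     : Vec Label 7 → List (Fin 4) → Certificate
  none      : Certificate

Valid : Pattern → Certificate → Set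
Valid P (nonlinear X Y i j) = X ≢ Y × i ≢ j × Same P (X , i) (Y , i) × Same P (X , j) (Y , j)
Valid P (spread ls)         = 8 ≤ length ls × AllPairs (λ l l' → ¬ Same P l l') ls
Valid P (copy₆ ℓ σ)         = Embeds P G6 (lookup ℓ) σ
Valid P (copy₇ ℓ σ)         = Embeds P G7 (lookup ℓ) σ
Valid P none                = ⊥

valid? : ∀ P r → Dec (Valid P r)
valid? P (nonlinear X Y i j) =
  ¬? (X ≟ Y) ×-dec ¬? (i ≟ j) ×-dec same? P (X , i) (Y , i) ×-dec same? P (X , j) (Y , j)
valid? P (spread ls) = (8 ≤? length ls) ×-dec allPairs? (λ l l' → ¬? (same? P l l')) ls
valid? P (copy₆ ℓ σ) = embeds? P G6 (lookup ℓ) σ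
valid? P (copy₇ ℓ σ) = embeds? P G7 (lookup ℓ) σ
valid? P none        = no (λ ())

-- Certificate search.  Candidates are only heuristics: whatever is found is
-- checked by valid?, so correctness never depends on how they are produced.
firstValid : Pattern → List Certificate → Certificate
firstValid P [] = none
firstValid P (r ∷ rs) = if does (valid? P r) then r else firstValid P rs

orderedPairs : ∀ {A : Set} → List A → List (A × A)
orderedPairs [] = []
orderedPairs (x ∷ xs) = map (x ,_) xs ++ orderedPairs xs

nonlinearCandidates : List Certificate
nonlinearCandidates = cartesianProductWith (λ { (X , Y) (i , j) → nonlinear X Y i j })
  (orderedPairs (allFin 4)) (orderedPairs (allFin 3))

distinctLabels : Pattern → List Label
distinctLabels P = keep [] (cartesianProduct (allFin 4) (allFin 3))
  where
  keep : List Label → List Label → List Label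
  keep acc [] = acc
  keep acc (l ∷ ls) = if does (any? (same? P l) acc) then keep acc ls else keep (l ∷ acc) ls

insertions : ∀ {A : Set} → A → List A → List (List A)
insertions x [] = (x ∷ []) ∷ []
insertions x (y ∷ ys) = (x ∷ y ∷ ys) ∷ map (y ∷_) (insertions x ys)

orderings : ∀ {A : Set} → List A → List (List A)
orderings [] = [] ∷ []
orderings (x ∷ xs) = concatMap (insertions x) (orderings xs)

-- Given that the pattern edges go to the edges σ, send a pattern vertex v to
-- the first edge X containing it, in the colour where X meets exactly the
-- edges containing v.
place : ∀ {m} → Pattern → List (Triple m) → List (Fin 4) → Fin m → Label
place P pat σ v = placeOn (fromMaybe zero (Maybe.map proj₂ (findᵇ incident (zip pat σ))))
  where
  incident : Triple _ × Fin 4 → Bool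
  incident (⟨ a , b , c ⟩ , _) = does (v ≟ a) ∨ does (v ≟ b) ∨ does (v ≟ c)
  placeOn : Fin 4 → Label
  placeOn X = X , fromMaybe zero (findᵇ fits (allFin 3))
    where
    fits : Fin 3 → Bool
    fits i = and (map (λ { (t , Y) → not (does (same? P (X , i) (Y , i)) xor incident (t , Y)) }) (zip pat σ))

-- The labels are tabulated once so that the checker shares their computation.
copyCandidates : Pattern → List Certificate
copyCandidates P = map (λ σ → copy₆ (tabulate (place P G6 σ)) σ) (orderings (allFin 4))
                ++ map (λ σ → copy₇ (tabulate (place P G7 σ)) σ) (orderings (allFin 4))

classify : Pattern → Certificate
classify P = firstValid P (nonlinearCandidates ++ spread (distinctLabels P) ∷ copyCandidates P)

allPatterns : List Pattern
allPatterns = vectorsOver normalForms 3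

exhaustive : All (λ P → Valid P (classify P)) allPatterns
exhaustive = toWitness {a? = All.all? (λ P → valid? P (classify P)) allPatterns} tt

module Configuration {n} (F : Hypergraph3 n) (c : Fin n → Fin 3)
  (partite : ∀ e → e ∈ᴸ edges F → ∀ i → ∣ e ∩ colourClass c i ∣ ≡ 1) (lin : Linear F)
  (E : Fin 4 → Subset n) (E∈F : ∀ X → E X ∈ᴸ edges F) (E-injective : Injective _≡_ _≡_ E) where

  coords : ∀ X → Coordinates c (E X)
  coords X = coordinates c (partite (E X) (E∈F X))

  open Coordinates

  vertex : Label → Fin n
  vertex (X , i) = point (coords X) i

  vertex-colour : ∀ l → c (vertex l) ≡ colour l
  vertex-colour (X , i) = point-colour (coords X) i

  vertex-∈ : ∀ X i → vertex (X , i) ∈ E X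
  vertex-∈ X i = point-∈ (coords X) i

  column : Fin 3 → Fin 4 → Fin n
  column i X = vertex (X , i)

  induced : Pattern
  induced = tabulate (λ i → normalForm (column i))

  induced-∈ : induced ∈ᴸ allPatterns
  induced-∈ = ∈-vectorsOver (class-∈ zero VecAll.∷ class-∈ (suc zero) VecAll.∷ class-∈ (suc (suc zero)) VecAll.∷ VecAll.[])
    where
    class-∈ : ∀ i → normalForm (column i) ∈ᴸ normalForms
    class-∈ i = normalForm-∈ (column i)

  induced-block : ∀ i X → lookup (lookup induced i) X ≡ representative (column i) X
  induced-block i X = trans (cong (λ q → lookup q X) (Vec.lookup∘tabulate (λ j → normalForm (column j)) i)) (lookup-normalForm (column i) X)

  same⇒≡ : ∀ {l l'} → Same induced l l' → vertex l ≡ vertex l'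
  same⇒≡ {X , i} {Y , .i} (refl , eq) =
    representative-sound (column i) (trans (sym (induced-block i X)) (trans eq (induced-block i Y)))

  ≡⇒same : ∀ {l l'} → vertex l ≡ vertex l' → Same induced l l'
  ≡⇒same {X , i} {Y , j} eq with trans (sym (vertex-colour (X , i))) (trans (cong c eq) (vertex-colour (Y , j)))
  ... | refl = refl , trans (induced-block i X) (trans (representative-complete (column i) eq) (sym (induced-block i Y)))

  nonlinear-impossible : ∀ {X Y i j} → ¬ Valid induced (nonlinear X Y i j)
  nonlinear-impossible {X} {Y} {i} {j} (X≢Y , i≢j , sameᵢ , sameⱼ) =
    <-irrefl refl (≤-trans two-shared (lin (E X) (E Y) (E∈F X) (E∈F Y) (λ eq → X≢Y (E-injective eq))))
    where
    shared : ∀ k → Same induced (X , k) (Y , k) → vertex (X , k) ∈ E X ∩ E Y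
    shared k s = x∈p∩q⁺ (vertex-∈ X k , subst (_∈ E Y) (sym (same⇒≡ s)) (vertex-∈ Y k))
    apart : vertex (X , i) ≢ vertex (X , j)
    apart eq = i≢j (trans (sym (vertex-colour (X , i))) (trans (cong c eq) (vertex-colour (X , j))))
    two-shared : 2 ≤ ∣ E X ∩ E Y ∣
    two-shared = card-lower (vertex (X , i) ∷ vertex (X , j) ∷ []) ((apart ∷ []) ∷ [] ∷ [])
                            (shared i sameᵢ ∷ shared j sameⱼ ∷ [])

  union : Subset n
  union = E zero ∪ E (suc zero) ∪ E (suc (suc zero)) ∪ E (suc (suc (suc zero)))

  vertex-∈-union : ∀ l → vertex l ∈ union
  vertex-∈-union (zero , i) = x∈p∪q⁺ (inj₁ (vertex-∈ _ i))
  vertex-∈-union (suc zero , i) = x∈p∪q⁺ (inj₂ (x∈p∪q⁺ (inj₁ (vertex-∈ _ i))))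
  vertex-∈-union (suc (suc zero) , i) = x∈p∪q⁺ (inj₂ (x∈p∪q⁺ (inj₂ (x∈p∪q⁺ (inj₁ (vertex-∈ _ i))))))
  vertex-∈-union (suc (suc (suc zero)) , i) = x∈p∪q⁺ (inj₂ (x∈p∪q⁺ (inj₂ (x∈p∪q⁺ (inj₂ (vertex-∈ _ i))))))

  spread-large : ∀ {ls} → Valid induced (spread ls) → 8 ≤ ∣ union ∣
  spread-large {ls} (8≤ , apart) = ≤-trans 8≤ (subst (_≤ ∣ union ∣) (length-map vertex ls)
    (card-lower (map vertex ls) (AllPairs.map⁺ (AllPairs.map (λ ¬same eq → ¬same (≡⇒same eq)) apart))
                (All.map⁺ (All.universal vertex-∈-union ls))))

  embedding : ∀ {m pat} {ℓ : Fin m → Label} {σ} → Embeds induced pat ℓ σ → ContainsCopy m pat F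
  embedding {m} {pat} {ℓ} (placed , ℓ-injective) =
    φ , (λ eq → ℓ-injective _ _ (≡⇒same eq)) , images-∈ placed
    where
    φ : Fin m → Fin n
    φ u = vertex (ℓ u)
    image-placed : ∀ {t X} → PlacedOn induced ℓ t X → image φ t ≡ E X
    image-placed {⟨ a , b , c' ⟩} {X} (onᵃ , onᵇ , onᶜ , colours) = ⊆-antisym into onto
      where
      on : ∀ {u} → Same induced (ℓ u) (X , colour (ℓ u)) → φ u ≡ vertex (X , colour (ℓ u))
      on = same⇒≡
      into : image φ ⟨ a , b , c' ⟩ ⊆ E X
      into w∈ with ∈-triple⁻ w∈
      ... | inj₁ refl = subst (_∈ E X) (sym (on onᵃ)) (vertex-∈ X _)
      ... | inj₂ (inj₁ refl) = subst (_∈ E X) (sym (on onᵇ)) (vertex-∈ X _)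
      ... | inj₂ (inj₂ refl) = subst (_∈ E X) (sym (on onᶜ)) (vertex-∈ X _)
      onto : E X ⊆ image φ ⟨ a , b , c' ⟩
      onto {w} w∈ = ∈-triple⁺ (Sum.map (at onᵃ) (Sum.map (at onᵇ) (at onᶜ)) (colours (c w)))
        where
        at : ∀ {u} → Same induced (ℓ u) (X , colour (ℓ u)) → c w ≡ colour (ℓ u) → w ≡ φ u
        at s cw≡ = trans (point-unique (coords X) w∈) (trans (cong (point (coords X)) cw≡) (sym (on s)))
    images-∈ : ∀ {ts σ} → Pointwise (PlacedOn induced ℓ) ts σ → All (λ t → image φ t ∈ᴸ edges F) ts
    images-∈ [] = []
    images-∈ (p ∷ ps) = subst (_∈ᴸ edges F) (sym (image-placed p)) (E∈F _) ∷ images-∈ ps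

  large-or-copy : 8 ≤ ∣ union ∣ ⊎ (ContainsCopy 6 G6 F ⊎ ContainsCopy 7 G7 F)
  large-or-copy = interpret (classify induced) (All.lookup exhaustive induced-∈)
    where
    interpret : ∀ r → Valid induced r → 8 ≤ ∣ union ∣ ⊎ (ContainsCopy 6 G6 F ⊎ ContainsCopy 7 G7 F)
    interpret (nonlinear _ _ _ _) v = ⊥-elim (nonlinear-impossible v)
    interpret (spread _) v = inj₁ (spread-large v)
    interpret (copy₆ _ _) v = inj₂ (inj₁ (embedding v))
    interpret (copy₇ _ _) v = inj₂ (inj₂ (embedding v))

quadruple : ∀ {A : Set} → A → A → A → A → Fin 4 → A
quadruple a b c d zero = a
quadruple a b c d (suc zero) = b
quadruple a b c d (suc (suc zero)) = c
quadruple a b c d (suc (suc (suc zero))) = d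

quadruple-all : ∀ {A : Set} {P : A → Set} {a b c d} → P a → P b → P c → P d →
                ∀ X → P (quadruple a b c d X)
quadruple-all pa pb pc pd zero = pa
quadruple-all pa pb pc pd (suc zero) = pb
quadruple-all pa pb pc pd (suc (suc zero)) = pc
quadruple-all pa pb pc pd (suc (suc (suc zero))) = pd

quadruple-injective : ∀ {n} {a b c d : Subset n} → Distinct4 a b c d → Injective _≡_ _≡_ (quadruple a b c d)
quadruple-injective (a≢b , a≢c , a≢d , b≢c , b≢d , c≢d) {X} {Y} = injective X Y
  where
  injective : ∀ X Y → quadruple _ _ _ _ X ≡ quadruple _ _ _ _ Y → X ≡ Y
  injective zero zero _ = refl
  injective zero (suc zero) eq = ⊥-elim (a≢b eq)
  injective zero (suc (suc zero)) eq = ⊥-elim (a≢c eq)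
  injective zero (suc (suc (suc zero))) eq = ⊥-elim (a≢d eq)
  injective (suc zero) zero eq = ⊥-elim (a≢b (sym eq))
  injective (suc zero) (suc zero) _ = refl
  injective (suc zero) (suc (suc zero)) eq = ⊥-elim (b≢c eq)
  injective (suc zero) (suc (suc (suc zero))) eq = ⊥-elim (b≢d eq)
  injective (suc (suc zero)) zero eq = ⊥-elim (a≢c (sym eq))
  injective (suc (suc zero)) (suc zero) eq = ⊥-elim (b≢c (sym eq))
  injective (suc (suc zero)) (suc (suc zero)) _ = refl
  injective (suc (suc zero)) (suc (suc (suc zero))) eq = ⊥-elim (c≢d eq)
  injective (suc (suc (suc zero))) zero eq = ⊥-elim (a≢d (sym eq))
  injective (suc (suc (suc zero))) (suc zero) eq = ⊥-elim (b≢d (sym eq))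
  injective (suc (suc (suc zero))) (suc (suc zero)) eq = ⊥-elim (c≢d (sym eq))
  injective (suc (suc (suc zero))) (suc (suc (suc zero))) _ = refl

small-quadruple⇒copy : ∀ {n} (F : Hypergraph3 n) → ThreePartite F → Linear F → ∀ {A B C D} →
  A ∈ᴸ edges F → B ∈ᴸ edges F → C ∈ᴸ edges F → D ∈ᴸ edges F → Distinct4 A B C D →
  ∣ A ∪ B ∪ C ∪ D ∣ ≤ 7 → ContainsCopy 6 G6 F ⊎ ContainsCopy 7 G7 F
small-quadruple⇒copy F (c , partite) lin {A} {B} {C} {D} A∈ B∈ C∈ D∈ distinct small =
  [ (λ large → ⊥-elim (<-irrefl refl (≤-trans large small))) , id ]
    (Configuration.large-or-copy F c partite lin (quadruple A B C D)
      (quadruple-all {P = _∈ᴸ edges F} A∈ B∈ C∈ D∈) (quadruple-injective distinct))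

copy-free⇒sparse : ∀ {n} (F : Hypergraph3 n) → ThreePartite F → Linear F →
                   ¬ ContainsCopy 6 G6 F × ¬ ContainsCopy 7 G7 F → G74Sparse F
copy-free⇒sparse F tp lin (no₆ , no₇) A B C D A∈ B∈ C∈ D∈ distinct small =
  [ no₆ , no₇ ] (small-quadruple⇒copy F tp lin A∈ B∈ C∈ D∈ distinct small)

proposition1 : ∀ {n} (F : Hypergraph3 n) → ThreePartite F → Linear F →
    (TwoCancellative F ⇔ (¬ ContainsCopy 6 G6 F × ¬ ContainsCopy 7 G7 F))
    × (G74Sparse F ⇔ (¬ ContainsCopy 6 G6 F × ¬ ContainsCopy 7 G7 F))
proposition1 F tp lin =
    mk⇔ (cancellative⇒copy-free F) (λ free → sparse⇒cancellative F lin (copy-free⇒sparse F tp lin free))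
  , mk⇔ (sparse⇒copy-free F) (copy-free⇒sparse F tp lin)
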